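{- Let $m\geq 8$ be even and let $n$ be a positive integer with $n\equiv 0 \pmod{m/2}$. Then $\Delta(S_n(1,m-4))=n-m+3$ and $R(S_n(1,m-4),W_m)\geq 2n$.
   Context: All graphs are finite, simple, undirected. $\Delta(G)$ is the maximum degree of $G$. For graphs $G,H$, the Ramsey number $R(G,H)$ is the smallest positive integer $N$ such that for every graph $F$ on $N$ vertices, either $F$ contains a subgraph isomorphic to $G$ or the complement $\overline{F}$ contains a subgraph isomorphic to $H$. $W_m$ is the wheel on $m+1$ vertices: a cycle $C_m$ plus one extra vertex adjacent to all vertices of the cycle. $S_k$ denotes the star on $k$ vertices. $S_n(l,s)$ denotes the tree of order $n$ obtained from the star $S_{n-sl}$ by subdividing each of $l$ chosen edges $s$ times. -}

module Defs where

open import Data.Bool using (Bool; true; false; _∧_; _∨_; not; if_then_else_)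
open import Data.Bool.Properties using (∨-comm)
open import Data.Nat using (ℕ; zero; suc; _+_; _*_; _∸_; _≤_; _<_; _%_; _≡ᵇ_; _<ᵇ_; _≤ᵇ_; _⊔_)
open import Data.Fin using (Fin; toℕ)
open import Data.List using (List; map; foldr; allFin)
open import Data.Nat.ListAction using (sum)
open import Data.Product using (Σ; _×_; _,_)
open import Data.Sum using (_⊎_)
open import Function.Definitions using (Injective)
open import Relation.Binary.PropositionalEquality using (_≡_; refl; cong; cong₂)

record Graph (n : ℕ) : Set where
  field
    adj    : Fin n → Fin n → Bool
    sym    : ∀ u v → adj u v ≡ adj v u
    irrefl : ∀ u → adj u u ≡ false
open Graph public

<ᵇ-irrefl : ∀ a → (a <ᵇ a) ≡ false
<ᵇ-irrefl zero = refl
<ᵇ-irrefl (suc a) = <ᵇ-irrefl a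

≡ᵇ-sym : ∀ a b → (a ≡ᵇ b) ≡ (b ≡ᵇ a)
≡ᵇ-sym zero zero = refl
≡ᵇ-sym zero (suc b) = refl
≡ᵇ-sym (suc a) zero = refl
≡ᵇ-sym (suc a) (suc b) = ≡ᵇ-sym a b

≡ᵇ-refl : ∀ a → (a ≡ᵇ a) ≡ true
≡ᵇ-refl zero = refl
≡ᵇ-refl (suc a) = ≡ᵇ-refl a

-- Build a graph on Fin n from an edge predicate e a b on labels a < b.
fromOrdered : (n : ℕ) → (ℕ → ℕ → Bool) → Graph n
fromOrdered n e = record
  { adj    = λ u v → sym' (toℕ u) (toℕ v)
  ; sym    = λ u v → ∨-comm ((toℕ u <ᵇ toℕ v) ∧ e (toℕ u) (toℕ v))
                            ((toℕ v <ᵇ toℕ u) ∧ e (toℕ v) (toℕ u))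
  ; irrefl = λ u → irr (toℕ u)
  }
  where
  sym' : ℕ → ℕ → Bool
  sym' a b = ((a <ᵇ b) ∧ e a b) ∨ ((b <ᵇ a) ∧ e b a)
  irr : ∀ a → sym' a a ≡ false
  irr a rewrite <ᵇ-irrefl a = refl

complement : ∀ {N} → Graph N → Graph N
complement {N} F = record
  { adj    = λ u v → not (adj F u v) ∧ not (toℕ u ≡ᵇ toℕ v)
  ; sym    = λ u v → cong₂ (λ x y → not x ∧ not y) (sym F u v) (≡ᵇ-sym (toℕ u) (toℕ v))
  ; irrefl = λ u → irr u
  }
  where
  irr : ∀ u → (not (adj F u u) ∧ not (toℕ u ≡ᵇ toℕ u)) ≡ false
  irr u rewrite ≡ᵇ-refl (toℕ u) with not (adj F u u)
  ... | true = refl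
  ... | false = refl

Contains : ∀ {N k} → Graph N → Graph k → Set
Contains {N} {k} F G =
  Σ (Fin k → Fin N) λ f →
    Injective _≡_ _≡_ f × (∀ u v → adj G u v ≡ true → adj F (f u) (f v) ≡ true)

Arrows : ∀ {a b} → ℕ → Graph a → Graph b → Set
Arrows N G H = (F : Graph N) → Contains F G ⊎ Contains (complement F) H

-- R(G,H) ≥ k : every positive N with N → (G,H) satisfies k ≤ N
-- (equivalently, the least such N is at least k).
RamseyAtLeast : ∀ {a b} → Graph a → Graph b → ℕ → Set
RamseyAtLeast G H k = ∀ N → 1 ≤ N → Arrows N G H → k ≤ N

degree : ∀ {n} → Graph n → Fin n → ℕ
degree {n} G v = sum (map (λ u → if adj G v u then 1 else 0) (allFin n))

maxDegree : ∀ {n} → Graph n → ℕ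
maxDegree {n} G = foldr _⊔_ 0 (map (degree G) (allFin n))

-- The wheel W_m on m+1 vertices: hub 0, cycle 1 - 2 - ... - m - 1.

wheel : (m : ℕ) → Graph (suc m)
wheel m = fromOrdered (suc m) e
  where
  -- called with a < b
  e : ℕ → ℕ → Bool
  e zero b = true
  e a b = (b ≡ᵇ suc a) ∨ ((a ≡ᵇ 1) ∧ (b ≡ᵇ m))

-- The tree S_n(l,s): star S_{n-sl} with centre 0 in which l edges are
-- each subdivided s times.  Labels: centre 0; leg j (j < l) is the path
-- 0 - (1+j(s+1)) - ... - ((j+1)(s+1)); the remaining vertices
-- l(s+1)+1, ..., n-1 are leaves attached to 0.
-- (Meaningful when n - s*l ≥ 2.)

spider : (n l s : ℕ) → Graph n
spider n l s = fromOrdered n e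
  where
  L : ℕ
  L = l * suc s
  -- called with a < b
  e : ℕ → ℕ → Bool
  e zero b = not (b ≤ᵇ L) ∨ (((b ∸ 1) % suc s) ≡ᵇ 0)
  e a b = (b ≡ᵇ suc a) ∧ (b ≤ᵇ L) ∧ not ((a % suc s) ≡ᵇ 0)

module Submission where

-- The colouring behind the bound has N ≤ 2n - 1 vertices: a clique on n - 1 of them, beside a
-- complete multipartite graph whose parts have size h = m/2.  The spider is connected, so it
-- lies on one side; the clique is too small, so it fills the other side, and with it the whole
-- part of its centre.  The h - 1 other vertices of that part are non-neighbours of the centre,
-- hence inner vertices of the subdivided leg, and no two of them are consecutive on it; but a
-- path of m - 4 = 2(h - 2) vertices has no h - 1 pairwise non-consecutive ones.  In the
-- complement (an independent set joined to disjoint copies of K_h) a hub in the independent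
-- set puts the whole m-cycle into one K_h, while a hub inside a K_h sees at least one vertex of
-- each consecutive rim pair inside its own K_h, i.e. h + 1 vertices in a K_h.

open import Defs hiding (sym)

open import Data.Bool using (Bool; true; false; T; _∧_; _∨_; not; if_then_else_)
open import Data.Bool.Properties using (T-≡)
open import Data.Empty using (⊥; ⊥-elim)
open import Data.Fin using (Fin; toℕ; fromℕ<; punchIn; punchOut)
import Data.Fin as Fin
open import Data.Fin.Properties
  using ( toℕ-injective; toℕ-fromℕ<; fromℕ<-injective; fromℕ<-toℕ; toℕ<n
        ; punchOut-injective; punchIn-injective; punchInᵢ≢i; any? )
  renaming (injective⇒≤ to Fin-injective⇒≤; suc-injective to Fin-suc-injective)
open import Data.List using ([]; _∷_; map; foldr; allFin; tabulate)
open import Data.List.Properties using (map-tabulate; tabulate-cong)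
open import Data.Nat.Base
open import Data.Nat.DivMod
  using ( _/_; m<n⇒m%n≡m; m%n<n; m≡m%n+[m/n]*n; +-distrib-/; m*n%n≡0; m*n/n≡m
        ; m<n⇒m/n≡0; m<n*o⇒m/o<n )
open import Data.Nat.Divisibility using (_∣_; divides)
open import Data.Nat.ListAction using (sum)
open import Data.Nat.Properties
open import Data.Nat.Solver using (module +-*-Solver)
open import Data.Product using (Σ; ∃; _×_; _,_; proj₁; proj₂)
open import Data.Sum using (_⊎_; inj₁; inj₂; [_,_])
open import Function using (_∘_; id; Injective)
open import Function.Bundles using (Equivalence)
open import Relation.Binary.Definitions using (tri<; tri≈; tri>)
open import Relation.Binary.PropositionalEquality
  using (_≡_; _≢_; refl; sym; trans; cong; cong₂; subst; subst₂; module ≡-Reasoning)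
open import Relation.Nullary using (¬_; yes; no)
open import Algebra.Properties.CommutativeSemigroup +-commutativeSemigroup using (interchange)
open +-*-Solver using (solve; _:+_; _:=_; con)

<⇒<ᵇ≡true : ∀ {m n} → m < n → (m <ᵇ n) ≡ true
<⇒<ᵇ≡true m<n = Equivalence.to T-≡ (<⇒<ᵇ m<n)

<ᵇ≡true⇒< : ∀ m n → (m <ᵇ n) ≡ true → m < n
<ᵇ≡true⇒< m n eq = <ᵇ⇒< m n (Equivalence.from T-≡ eq)

≮⇒<ᵇ≡false : ∀ {m n} → ¬ m < n → (m <ᵇ n) ≡ false
≮⇒<ᵇ≡false {m} {n} m≮n with m <ᵇ n in eq
... | false = refl
... | true  = ⊥-elim (m≮n (<ᵇ≡true⇒< m n eq))

<ᵇ≡false⇒≥ : ∀ m n → (m <ᵇ n) ≡ false → n ≤ m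
<ᵇ≡false⇒≥ m n eq = ≮⇒≥ (subst T eq ∘ <⇒<ᵇ)

≡ᵇ≡true⇒≡ : ∀ m n → (m ≡ᵇ n) ≡ true → m ≡ n
≡ᵇ≡true⇒≡ m n eq = ≡ᵇ⇒≡ m n (Equivalence.from T-≡ eq)

-- adj (fromOrdered n e) u v unfolds to orderedSym e (toℕ u) (toℕ v).
orderedSym : (ℕ → ℕ → Bool) → ℕ → ℕ → Bool
orderedSym e a b = ((a <ᵇ b) ∧ e a b) ∨ ((b <ᵇ a) ∧ e b a)

orderedSym-refl : ∀ e a → orderedSym e a a ≡ false
orderedSym-refl e a rewrite <ᵇ-irrefl a = refl

orderedSym-< : ∀ e {a b} → a < b → orderedSym e a b ≡ e a b
orderedSym-< e {a} {b} a<b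
  rewrite <⇒<ᵇ≡true a<b | ≮⇒<ᵇ≡false (<⇒≯ a<b) with e a b
... | true  = refl
... | false = refl

orderedSym-> : ∀ e {a b} → b < a → orderedSym e a b ≡ e b a
orderedSym-> e {a} {b} b<a
  rewrite <⇒<ᵇ≡true b<a | ≮⇒<ᵇ≡false (<⇒≯ b<a) = refl

orderedSym-sym : ∀ e → (∀ a b → e a b ≡ e b a) → ∀ {a b} → a ≢ b → orderedSym e a b ≡ e a b
orderedSym-sym e e-sym {a} {b} a≢b with <-cmp a b
... | tri< a<b _ _ = orderedSym-< e a<b
... | tri≈ _ a≡b _ = ⊥-elim (a≢b a≡b)
... | tri> _ _ b<a = trans (orderedSym-> e b<a) (e-sym b a)

[m*n+o]/n≡m : ∀ m n {o} .{{_ : NonZero n}} → o < n → (m * n + o) / n ≡ m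
[m*n+o]/n≡m m n {o} o<n = begin
  (m * n + o) / n   ≡⟨ +-distrib-/ (m * n) o remainders<n ⟩
  m * n / n + o / n ≡⟨ cong₂ _+_ (m*n/n≡m m n) (m<n⇒m/n≡0 o<n) ⟩
  m + 0             ≡⟨ +-identityʳ m ⟩
  m                 ∎
  where
  open ≡-Reasoning
  remainders<n : (m * n) % n + o % n < n
  remainders<n = subst (_< n) (sym (cong₂ _+_ (m*n%n≡0 m n) (m<n⇒m%n≡m o<n))) o<n

injective⇒≤ : ∀ {a c} (f : Fin a → ℕ) → Injective _≡_ _≡_ f → (∀ i → f i < c) → a ≤ c
injective⇒≤ f f-inj f<c =
  Fin-injective⇒≤ (λ {i} {j} eq → f-inj (fromℕ<-injective (f i) (f j) (f<c i) (f<c j) eq))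

injective-avoiding⇒< : ∀ {a c} (f : Fin a → ℕ) → Injective _≡_ _≡_ f → (∀ i → f i < c) →
                        ∀ {y} → y < c → (∀ i → f i ≢ y) → a < c
injective-avoiding⇒< {c = suc c} f f-inj f<c {y} y<c f≢y =
  s≤s (Fin-injective⇒≤ (λ {i} {j} eq →
    f-inj (fromℕ<-injective (f i) (f j) (f<c i) (f<c j) (punchOut-injective (y≢f i) (y≢f j) eq))))
  where
  y≢f : ∀ i → fromℕ< y<c ≢ fromℕ< (f<c i)
  y≢f i eq = f≢y i (sym (fromℕ<-injective y (f i) y<c (f<c i) eq))

injective⇒surjective : ∀ {n} (f : Fin n → ℕ) → Injective _≡_ _≡_ f → (∀ i → f i < n) →
                        ∀ {y} → y < n → ∃ λ i → f i ≡ y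
injective⇒surjective f f-inj f<n {y} y<n with any? (λ i → f i ≟ y)
... | yes hit = hit
... | no miss = ⊥-elim (<-irrefl refl (injective-avoiding⇒< f f-inj f<n y<n (λ i eq → miss (i , eq))))

m<n+n⇒⌊m/2⌋<n : ∀ {m n} → m < n + n → ⌊ m /2⌋ < n
m<n+n⇒⌊m/2⌋<n {zero}        {suc n} _ = z<s
m<n+n⇒⌊m/2⌋<n {suc zero}    {suc n} _ = z<s
m<n+n⇒⌊m/2⌋<n {suc (suc m)} {suc n} (s<s m<n+1+n) =
  s<s (m<n+n⇒⌊m/2⌋<n (s<s⁻¹ (subst (suc m <_) (+-suc n n) m<n+1+n)))

⌊m/2⌋≡⌊n/2⌋⇒m≡n⊎adjacent : ∀ m n → ⌊ m /2⌋ ≡ ⌊ n /2⌋ → m ≡ n ⊎ suc m ≡ n ⊎ suc n ≡ m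
⌊m/2⌋≡⌊n/2⌋⇒m≡n⊎adjacent zero          zero          _  = inj₁ refl
⌊m/2⌋≡⌊n/2⌋⇒m≡n⊎adjacent zero          (suc zero)    _  = inj₂ (inj₁ refl)
⌊m/2⌋≡⌊n/2⌋⇒m≡n⊎adjacent (suc zero)    zero          _  = inj₂ (inj₂ refl)
⌊m/2⌋≡⌊n/2⌋⇒m≡n⊎adjacent (suc zero)    (suc zero)    _  = inj₁ refl
⌊m/2⌋≡⌊n/2⌋⇒m≡n⊎adjacent (suc (suc m)) (suc (suc n)) eq
  with ⌊m/2⌋≡⌊n/2⌋⇒m≡n⊎adjacent m n (suc-injective eq)
... | inj₁ refl        = inj₁ refl
... | inj₂ (inj₁ refl) = inj₂ (inj₁ refl)
... | inj₂ (inj₂ refl) = inj₂ (inj₂ refl)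

-- Halving identifies at most the two members of a consecutive pair.
nonConsecutive-injective⇒≤ : ∀ {a k} (f : Fin a → ℕ) → Injective _≡_ _≡_ f → (∀ i → f i < k + k) →
                              (∀ i j → suc (f i) ≢ f j) → a ≤ k
nonConsecutive-injective⇒≤ f f-inj f<k+k apart =
  injective⇒≤ (⌊_/2⌋ ∘ f) halves-injective (m<n+n⇒⌊m/2⌋<n ∘ f<k+k)
  where
  halves-injective : Injective _≡_ _≡_ (⌊_/2⌋ ∘ f)
  halves-injective {i} {j} eq with ⌊m/2⌋≡⌊n/2⌋⇒m≡n⊎adjacent (f i) (f j) eq
  ... | inj₁ fi≡fj       = f-inj fi≡fj
  ... | inj₂ (inj₁ i→j) = ⊥-elim (apart i j i→j)
  ... | inj₂ (inj₂ j→i) = ⊥-elim (apart j i j→i)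

indicator : Bool → ℕ
indicator b = if b then 1 else 0

sumBelow : ℕ → (ℕ → ℕ) → ℕ
sumBelow zero    f = 0
sumBelow (suc n) f = f 0 + sumBelow n (f ∘ suc)

sum-tabulate-toℕ : ∀ n (f : ℕ → ℕ) → sum (tabulate {n = n} (f ∘ toℕ)) ≡ sumBelow n f
sum-tabulate-toℕ zero    f = refl
sum-tabulate-toℕ (suc n) f = cong (f 0 +_) (sum-tabulate-toℕ n (f ∘ suc))

sumBelow-mono-≤ : ∀ n {f g} → (∀ x → f x ≤ g x) → sumBelow n f ≤ sumBelow n g
sumBelow-mono-≤ zero    f≤g = z≤n
sumBelow-mono-≤ (suc n) f≤g = +-mono-≤ (f≤g 0) (sumBelow-mono-≤ n (f≤g ∘ suc))

sumBelow-distrib-+ : ∀ n f g → sumBelow n (λ x → f x + g x) ≡ sumBelow n f + sumBelow n g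
sumBelow-distrib-+ zero    f g = refl
sumBelow-distrib-+ (suc n) f g
  rewrite sumBelow-distrib-+ n (f ∘ suc) (g ∘ suc) = interchange (f 0) (g 0) _ _

sumBelow-split : ∀ a b f → sumBelow (a + b) f ≡ sumBelow a f + sumBelow b (λ x → f (a + x))
sumBelow-split zero    b f = refl
sumBelow-split (suc a) b f =
  trans (cong (f 0 +_) (sumBelow-split a b (f ∘ suc))) (sym (+-assoc (f 0) _ _))

sumBelow-zero : ∀ n f → (∀ x → x < n → f x ≡ 0) → sumBelow n f ≡ 0
sumBelow-zero zero    f f≡0 = refl
sumBelow-zero (suc n) f f≡0 rewrite f≡0 0 z<s =
  sumBelow-zero n (f ∘ suc) (λ x x<n → f≡0 (suc x) (s<s x<n))

sumBelow-one : ∀ n f → (∀ x → f x ≡ 1) → sumBelow n f ≡ n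
sumBelow-one zero    f f≡1 = refl
sumBelow-one (suc n) f f≡1 rewrite f≡1 0 = cong suc (sumBelow-one n (f ∘ suc) (f≡1 ∘ suc))

sumBelow-≡ᵇ≤1 : ∀ n c → sumBelow n (λ x → indicator (x ≡ᵇ c)) ≤ 1
sumBelow-≡ᵇ≤1 zero    c       = z≤n
sumBelow-≡ᵇ≤1 (suc n) zero    = ≤-reflexive (cong suc (sumBelow-zero n _ (λ _ _ → refl)))
sumBelow-≡ᵇ≤1 (suc n) (suc c) = sumBelow-≡ᵇ≤1 n c

degree-sumBelow : ∀ {n} (G : Graph n) v (a : ℕ → Bool) → (∀ u → adj G v u ≡ a (toℕ u)) →
                  degree G v ≡ sumBelow n (indicator ∘ a)
degree-sumBelow {n} G v a adj≡a = begin
  sum (map (indicator ∘ adj G v) (allFin n))   ≡⟨ cong sum (map-tabulate {n = n} id _) ⟩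
  sum (tabulate (indicator ∘ adj G v))         ≡⟨ cong sum (tabulate-cong (cong indicator ∘ adj≡a)) ⟩
  sum (tabulate {n = n} (indicator ∘ a ∘ toℕ)) ≡⟨ sum-tabulate-toℕ n (indicator ∘ a) ⟩
  sumBelow n (indicator ∘ a)                   ∎
  where open ≡-Reasoning

maxDegree-attained : ∀ {n} (G : Graph (suc n)) → (∀ v → degree G v ≤ degree G Fin.zero) →
                     maxDegree G ≡ degree G Fin.zero
maxDegree-attained {n} G deg≤ = m≥n⇒m⊔n≡m (foldr-⊔-lub (tabulate {n = n} Fin.suc))
  where
  foldr-⊔-lub : ∀ vs → foldr _⊔_ 0 (map (degree G) vs) ≤ degree G Fin.zero
  foldr-⊔-lub []       = z≤n
  foldr-⊔-lub (v ∷ vs) = ⊔-lub (deg≤ v) (foldr-⊔-lub vs)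

-- The spider S_n(1,s)

-- The edge relation of Defs.spider for l = 1, written out so that it can be unfolded.
spiderEdge : ℕ → ℕ → ℕ → Bool
spiderEdge s zero    b = not (b ≤ᵇ 1 * suc s) ∨ (((b ∸ 1) % suc s) ≡ᵇ 0)
spiderEdge s (suc a) b = (b ≡ᵇ suc (suc a)) ∧ (b ≤ᵇ 1 * suc s) ∧ not ((suc a % suc s) ≡ᵇ 0)

spiderAdj : ℕ → ℕ → ℕ → Bool
spiderAdj s = orderedSym (spiderEdge s)

adj-spider : ∀ n s (u v : Fin n) → adj (spider n 1 s) u v ≡ spiderAdj s (toℕ u) (toℕ v)
adj-spider n s u v with toℕ u | toℕ v
... | zero  | zero  = refl
... | zero  | suc _ = refl
... | suc _ | zero  = refl
... | suc _ | suc _ = refl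

spiderAdj-centre-leg : ∀ s → spiderAdj s 0 1 ≡ true
spiderAdj-centre-leg s = refl

spiderAdj-centre-leaf : ∀ s {b} → suc s < b → spiderAdj s 0 b ≡ true
spiderAdj-centre-leaf s {suc b} (s<s s<b)
  rewrite +-identityʳ s | ≮⇒<ᵇ≡false (≤⇒≯ s<b) = refl

spiderAdj-leg : ∀ s {a} → a < s → spiderAdj s (suc a) (suc (suc a)) ≡ true
spiderAdj-leg s {a} a<s
  rewrite orderedSym-< (spiderEdge s) (n<1+n (suc a)) | +-identityʳ s | ≡ᵇ-refl a
        | <⇒<ᵇ≡true a<s | m<n⇒m%n≡m (s<s a<s) = refl

spiderAdj-path : ∀ s {a} → a ≤ s → spiderAdj s a (suc a) ≡ true
spiderAdj-path s {zero}  _      = spiderAdj-centre-leg s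
spiderAdj-path s {suc a} 1+a≤s = spiderAdj-leg s 1+a≤s

spiderAdj-centre-nonleaf : ∀ s {b} → 2 ≤ b → b ≤ suc s → spiderAdj s 0 b ≡ false
spiderAdj-centre-nonleaf s {suc (suc b)} (s≤s (s≤s z≤n)) b≤1+s
  rewrite +-identityʳ s | <⇒<ᵇ≡true b≤1+s | m<n⇒m%n≡m b≤1+s = refl

spiderAdj-offCentre : ∀ s a b → spiderAdj s (suc a) b ≡ true → b ≡ 0 ⊎ suc b ≡ suc a ⊎ b ≡ suc (suc a)
spiderAdj-offCentre s a b adj≡true with <-cmp b (suc a)
... | tri< b<1+a _ _ = below b (trans (sym (orderedSym-> (spiderEdge s) b<1+a)) adj≡true)
  where
  below : ∀ b → spiderEdge s b (suc a) ≡ true → b ≡ 0 ⊎ suc b ≡ suc a ⊎ b ≡ suc (suc a)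
  below zero    _    = inj₁ refl
  below (suc b) edge with suc a ≡ᵇ suc (suc b) in eq
  below (suc b) ()   | false
  ... | true = inj₂ (inj₁ (sym (≡ᵇ≡true⇒≡ (suc a) (suc (suc b)) eq)))
... | tri≈ _ refl _ with () ← trans (sym (orderedSym-refl (spiderEdge s) b)) adj≡true
... | tri> _ _ 1+a<b = inj₂ (inj₂ (above (trans (sym (orderedSym-< (spiderEdge s) 1+a<b)) adj≡true)))
  where
  above : spiderEdge s (suc a) b ≡ true → b ≡ suc (suc a)
  above edge with b ≡ᵇ suc (suc a) in eq
  above ()   | false
  ... | true = ≡ᵇ≡true⇒≡ b _ eq

spider-degree-offCentre : ∀ n s a (v : Fin n) → toℕ v ≡ suc a → degree (spider n 1 s) v ≤ 3
spider-degree-offCentre n s a v v≡1+a = begin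
  degree (spider n 1 s) v
    ≡⟨ degree-sumBelow (spider n 1 s) v (spiderAdj s (suc a)) adj-v ⟩
  sumBelow n (indicator ∘ spiderAdj s (suc a))
    ≤⟨ sumBelow-mono-≤ n neighbours ⟩
  sumBelow n (λ b → is 0 b + (is a b + is (suc (suc a)) b))
    ≡⟨ trans (sumBelow-distrib-+ n _ _) (cong (sumBelow n (is 0) +_) (sumBelow-distrib-+ n _ _)) ⟩
  sumBelow n (is 0) + (sumBelow n (is a) + sumBelow n (is (suc (suc a))))
    ≤⟨ +-mono-≤ (sumBelow-≡ᵇ≤1 n 0) (+-mono-≤ (sumBelow-≡ᵇ≤1 n a) (sumBelow-≡ᵇ≤1 n (suc (suc a)))) ⟩
  3 ∎
  where
  open ≤-Reasoning
  is : ℕ → ℕ → ℕ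
  is c b = indicator (b ≡ᵇ c)
  adj-v : ∀ u → adj (spider n 1 s) v u ≡ spiderAdj s (suc a) (toℕ u)
  adj-v u = trans (adj-spider n s v u) (cong (λ x → spiderAdj s x (toℕ u)) v≡1+a)
  neighbours : ∀ b → indicator (spiderAdj s (suc a) b) ≤ is 0 b + (is a b + is (suc (suc a)) b)
  neighbours b with spiderAdj s (suc a) b in eq
  ... | false = z≤n
  ... | true with spiderAdj-offCentre s a b eq
  ...   | inj₁ refl = s≤s z≤n
  ...   | inj₂ (inj₁ refl) rewrite ≡ᵇ-refl b = ≤-trans (s≤s z≤n) (m≤n+m _ (is 0 b))
  ...   | inj₂ (inj₂ refl) rewrite ≡ᵇ-refl b = ≤-trans (m≤n+m _ (is a b)) (m≤n+m _ (is 0 b))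

spider-degree-centre : ∀ s r → degree (spider (2 + s + r) 1 s) Fin.zero ≡ suc r
spider-degree-centre s r = begin
  degree (spider n 1 s) Fin.zero
    ≡⟨ degree-sumBelow (spider n 1 s) Fin.zero (spiderAdj s 0) (adj-spider n s Fin.zero) ⟩
  sumBelow n neighbour
    ≡⟨ cong suc (sumBelow-split s r _) ⟩
  suc (sumBelow s (neighbour ∘ (2 +_)) + sumBelow r (neighbour ∘ (2 +_) ∘ (s +_)))
    ≡⟨ cong suc (cong₂ _+_ (sumBelow-zero s _ inner) (sumBelow-one r _ leaf)) ⟩
  suc r ∎
  where
  open ≡-Reasoning
  n : ℕ
  n = 2 + s + r
  neighbour : ℕ → ℕ
  neighbour = indicator ∘ spiderAdj s 0
  inner : ∀ x → x < s → neighbour (2 + x) ≡ 0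
  inner x x<s rewrite spiderAdj-centre-nonleaf s {2 + x} (s≤s (s≤s z≤n)) (s<s x<s) = refl
  leaf : ∀ x → neighbour (2 + (s + x)) ≡ 1
  leaf x rewrite spiderAdj-centre-leaf s {2 + (s + x)} (s<s (s≤s (m≤m+n s x))) = refl

maxDegree-spider : ∀ s r → 2 ≤ r → maxDegree (spider (2 + s + r) 1 s) ≡ suc r
maxDegree-spider s r 2≤r =
  trans (maxDegree-attained (spider n 1 s) degree≤centre) (spider-degree-centre s r)
  where
  n : ℕ
  n = 2 + s + r
  degree≤centre : ∀ v → degree (spider n 1 s) v ≤ degree (spider n 1 s) Fin.zero
  degree≤centre v = byLabel (toℕ v) refl
    where
    open ≤-Reasoning
    byLabel : ∀ k → toℕ v ≡ k → degree (spider n 1 s) v ≤ degree (spider n 1 s) Fin.zero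
    byLabel zero    v≡0   = ≤-reflexive (cong (degree (spider n 1 s)) (toℕ-injective {j = Fin.zero} v≡0))
    byLabel (suc a) v≡1+a = begin
      degree (spider n 1 s) v        ≤⟨ spider-degree-offCentre n s a v v≡1+a ⟩
      3                              ≤⟨ s≤s 2≤r ⟩
      suc r                          ≡⟨ spider-degree-centre s r ⟨
      degree (spider n 1 s) Fin.zero ∎

-- The wheel W_m

-- The edge relation of Defs.wheel, written out so that it can be unfolded.
wheelEdge : ℕ → ℕ → ℕ → Bool
wheelEdge m zero    b = true
wheelEdge m (suc a) b = (b ≡ᵇ suc (suc a)) ∨ ((suc a ≡ᵇ 1) ∧ (b ≡ᵇ m))

adj-wheel : ∀ m (u v : Fin (suc m)) → adj (wheel m) u v ≡ orderedSym (wheelEdge m) (toℕ u) (toℕ v)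
adj-wheel m u v with toℕ u | toℕ v
... | zero  | zero  = refl
... | zero  | suc _ = refl
... | suc _ | zero  = refl
... | suc _ | suc _ = refl

wheel-spoke : ∀ m (i : Fin m) → adj (wheel m) Fin.zero (Fin.suc i) ≡ true
wheel-spoke m i = adj-wheel m Fin.zero (Fin.suc i)

wheel-rim : ∀ m (i j : Fin m) → toℕ j ≡ suc (toℕ i) → adj (wheel m) (Fin.suc i) (Fin.suc j) ≡ true
wheel-rim m i j j≡1+i
  rewrite adj-wheel m (Fin.suc i) (Fin.suc j) | j≡1+i
        | orderedSym-< (wheelEdge m) (n<1+n (suc (toℕ i))) | ≡ᵇ-refl (toℕ i) = refl

-- K_p on the labels below p, beside the complete multipartite graph whose parts are the
-- blocks of h consecutive labels from p on.
module _ (p h : ℕ) .{{_ : NonZero h}} where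

  part : ℕ → ℕ
  part x = (x ∸ p) / h

  slot : ℕ → ℕ
  slot x = (x ∸ p) % h

  cliqueMultipartiteEdge : ℕ → ℕ → Bool
  cliqueMultipartiteEdge a b =
    if a <ᵇ p then b <ᵇ p else (if b <ᵇ p then false else not (part a ≡ᵇ part b))

  cliqueMultipartiteEdge-sym : ∀ a b → cliqueMultipartiteEdge a b ≡ cliqueMultipartiteEdge b a
  cliqueMultipartiteEdge-sym a b with a <ᵇ p | b <ᵇ p
  ... | true  | true  = refl
  ... | true  | false = refl
  ... | false | true  = refl
  ... | false | false = cong not (≡ᵇ-sym (part a) (part b))

  cliqueMultipartite : (N : ℕ) → Graph N
  cliqueMultipartite N = fromOrdered N cliqueMultipartiteEdge

  adj-cliqueMultipartite : ∀ {N} (u v : Fin N) → toℕ u ≢ toℕ v →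
                           adj (cliqueMultipartite N) u v ≡ cliqueMultipartiteEdge (toℕ u) (toℕ v)
  adj-cliqueMultipartite u v = orderedSym-sym cliqueMultipartiteEdge cliqueMultipartiteEdge-sym

  cliqueMultipartiteEdge-clique : ∀ {a b} → a < p → b < p → cliqueMultipartiteEdge a b ≡ true
  cliqueMultipartiteEdge-clique a<p b<p rewrite <⇒<ᵇ≡true a<p | <⇒<ᵇ≡true b<p = refl

  cliqueMultipartiteEdge-sameSide : ∀ a b → cliqueMultipartiteEdge a b ≡ true → (a <ᵇ p) ≡ (b <ᵇ p)
  cliqueMultipartiteEdge-sameSide a b edge with a <ᵇ p | b <ᵇ p
  cliqueMultipartiteEdge-sameSide a b () | true  | false
  cliqueMultipartiteEdge-sameSide a b () | false | true
  ... | true  | true  = refl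
  ... | false | false = refl

  cliqueMultipartiteEdge-crossesParts : ∀ {a b} → p ≤ a → p ≤ b →
    cliqueMultipartiteEdge a b ≡ true → part a ≢ part b
  cliqueMultipartiteEdge-crossesParts {a} {b} p≤a p≤b edge same
    rewrite ≮⇒<ᵇ≡false (≤⇒≯ p≤a) | ≮⇒<ᵇ≡false (≤⇒≯ p≤b) | same | ≡ᵇ-refl (part b)
    with () ← edge

  cliqueMultipartiteEdge-false⇒samePart : ∀ {a b} → p ≤ a → p ≤ b →
    cliqueMultipartiteEdge a b ≡ false → part a ≡ part b
  cliqueMultipartiteEdge-false⇒samePart {a} {b} p≤a p≤b nonEdge
    rewrite ≮⇒<ᵇ≡false (≤⇒≯ p≤a) | ≮⇒<ᵇ≡false (≤⇒≯ p≤b) with part a ≡ᵇ part b in eq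
  ... | true = ≡ᵇ≡true⇒≡ (part a) (part b) eq
  cliqueMultipartiteEdge-false⇒samePart p≤a p≤b () | false

  part-slot-injective : ∀ {x y} → p ≤ x → p ≤ y → part x ≡ part y → slot x ≡ slot y → x ≡ y
  part-slot-injective {x} {y} p≤x p≤y part≡ slot≡ = begin
    x                         ≡⟨ m∸n+n≡m p≤x ⟨
    (x ∸ p) + p               ≡⟨ cong (_+ p) (m≡m%n+[m/n]*n (x ∸ p) h) ⟩
    (slot x + part x * h) + p ≡⟨ cong₂ (λ r c → (r + c * h) + p) slot≡ part≡ ⟩
    (slot y + part y * h) + p ≡⟨ cong (_+ p) (m≡m%n+[m/n]*n (y ∸ p) h) ⟨
    (y ∸ p) + p               ≡⟨ m∸n+n≡m p≤y ⟩
    y                         ∎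
    where open ≡-Reasoning

-- No wheel in the complement of the colouring

adj-complement : ∀ {N} (F : Graph N) x y → adj (complement F) x y ≡ true →
                 adj F x y ≡ false × toℕ x ≢ toℕ y
adj-complement F x y edge with adj F x y | toℕ x ≡ᵇ toℕ y in eq
adj-complement F x y () | true  | _
adj-complement F x y () | false | true
... | false | false = refl , subst T eq ∘ ≡⇒≡ᵇ (toℕ x) (toℕ y)

module WheelInComplement (N p h′ : ℕ)
  (g : Fin (suc (suc h′ + suc h′)) → Fin N) (g-injective : Injective _≡_ _≡_ g)
  (g-hom : ∀ u v → adj (wheel (suc h′ + suc h′)) u v ≡ true →
                   adj (complement (cliqueMultipartite p (suc h′) N)) (g u) (g v) ≡ true) where

  h m : ℕ
  h = suc h′
  m = h + h

  hub : Fin (suc m)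
  hub = Fin.zero

  rim : Fin m → Fin (suc m)
  rim = Fin.suc

  label : Fin (suc m) → ℕ
  label u = toℕ (g u)

  label-injective : Injective _≡_ _≡_ label
  label-injective = g-injective ∘ toℕ-injective

  Edge : Fin (suc m) → Fin (suc m) → Set
  Edge u v = adj (wheel m) u v ≡ true

  nonEdge : ∀ u v → Edge u v → cliqueMultipartiteEdge p h (label u) (label v) ≡ false
  nonEdge u v uv with adj-complement (cliqueMultipartite p h N) (g u) (g v) (g-hom u v uv)
  ... | nonAdj , distinct = trans (sym (adj-cliqueMultipartite p h (g u) (g v) distinct)) nonAdj

  notBothInClique : ∀ u v → Edge u v → label u < p → label v < p → ⊥
  notBothInClique u v uv u<p v<p
    with () ← trans (sym (cliqueMultipartiteEdge-clique p h u<p v<p)) (nonEdge u v uv)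

  samePart : ∀ u v → Edge u v → p ≤ label u → p ≤ label v →
             part p h (label u) ≡ part p h (label v)
  samePart u v uv p≤u p≤v = cliqueMultipartiteEdge-false⇒samePart p h p≤u p≤v (nonEdge u v uv)

  slot<h : ∀ u → slot p h (label u) < h
  slot<h u = m%n<n (label u ∸ p) h

  hubInClique : label hub < p → ⊥
  hubInClique hub<p = <-irrefl refl (<-≤-trans (m<m+n h z<s)
    (injective⇒≤ (slot p h ∘ label ∘ rim) slots-injective (slot<h ∘ rim)))
    where
    rimOutside : ∀ i → p ≤ label (rim i)
    rimOutside i with label (rim i) <? p
    ... | yes rim<p = ⊥-elim (notBothInClique hub (rim i) (wheel-spoke m i) hub<p rim<p)
    ... | no  rim≮p = ≮⇒≥ rim≮p
    rimPart : ∀ x (x<m : x < m) → part p h (label (rim (fromℕ< x<m))) ≡ part p h (label (rim Fin.zero))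
    rimPart zero    x<m   = refl
    rimPart (suc x) 1+x<m =
      trans (sym (samePart _ _ (wheel-rim m _ _ consecutive) (rimOutside _) (rimOutside _))) (rimPart x x<m)
      where
      x<m : x < m
      x<m = <-trans (n<1+n x) 1+x<m
      consecutive : toℕ (fromℕ< 1+x<m) ≡ suc (toℕ (fromℕ< x<m))
      consecutive = trans (toℕ-fromℕ< 1+x<m) (cong suc (sym (toℕ-fromℕ< x<m)))
    rimPart′ : ∀ i → part p h (label (rim i)) ≡ part p h (label (rim Fin.zero))
    rimPart′ i = subst (λ j → part p h (label (rim j)) ≡ _) (fromℕ<-toℕ i (toℕ<n i))
                       (rimPart (toℕ i) (toℕ<n i))
    slots-injective : Injective _≡_ _≡_ (slot p h ∘ label ∘ rim)
    slots-injective {i} {j} slot≡ = Fin-suc-injective (label-injective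
      (part-slot-injective p h (rimOutside i) (rimOutside j) (trans (rimPart′ i) (sym (rimPart′ j))) slot≡))

  hubOutside : p ≤ label hub → ⊥
  hubOutside p≤hub = <-irrefl refl
    (injective-avoiding⇒< (slot p h ∘ label ∘ rim ∘ chosen) chosen-slots-injective
                          (slot<h ∘ rim ∘ chosen) (slot<h hub) chosen-avoids-hub)
    where
    2a+1<m : (a : Fin h) → suc (toℕ a + toℕ a) < m
    2a+1<m a = subst (_≤ m) (+-suc (suc (toℕ a)) (toℕ a)) (+-mono-≤ (toℕ<n a) (toℕ<n a))
    2a<m : (a : Fin h) → toℕ a + toℕ a < m
    2a<m a = <-trans (n<1+n _) (2a+1<m a)
    even odd : Fin h → Fin m
    even a = fromℕ< (2a<m a)
    odd  a = fromℕ< (2a+1<m a)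
    choose : (a : Fin h) → Σ (Fin m) λ i → ⌊ toℕ i /2⌋ ≡ toℕ a × p ≤ label (rim i)
    choose a with label (rim (even a)) <? p | label (rim (odd a)) <? p
    ... | no even≮p | _ =
      even a , trans (cong ⌊_/2⌋ (toℕ-fromℕ< (2a<m a))) (sym (n≡⌊n+n/2⌋ (toℕ a))) , ≮⇒≥ even≮p
    ... | yes _ | no odd≮p =
      odd a , trans (cong ⌊_/2⌋ (toℕ-fromℕ< (2a+1<m a))) (sym (n≡⌈n+n/2⌉ (toℕ a))) , ≮⇒≥ odd≮p
    ... | yes even<p | yes odd<p =
      ⊥-elim (notBothInClique _ _ (wheel-rim m (even a) (odd a) consecutive) even<p odd<p)
      where
      consecutive : toℕ (odd a) ≡ suc (toℕ (even a))
      consecutive = trans (toℕ-fromℕ< (2a+1<m a)) (cong suc (sym (toℕ-fromℕ< (2a<m a))))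
    chosen : Fin h → Fin m
    chosen a = proj₁ (choose a)
    chosen-outside : ∀ a → p ≤ label (rim (chosen a))
    chosen-outside a = proj₂ (proj₂ (choose a))
    chosen-part : ∀ a → part p h (label (rim (chosen a))) ≡ part p h (label hub)
    chosen-part a = sym (samePart hub _ (wheel-spoke m (chosen a)) p≤hub (chosen-outside a))
    chosen-slots-injective : Injective _≡_ _≡_ (slot p h ∘ label ∘ rim ∘ chosen)
    chosen-slots-injective {a} {b} slot≡ = toℕ-injective (begin
      toℕ a                ≡⟨ proj₁ (proj₂ (choose a)) ⟨
      ⌊ toℕ (chosen a) /2⌋ ≡⟨ cong (⌊_/2⌋ ∘ toℕ) same-index ⟩
      ⌊ toℕ (chosen b) /2⌋ ≡⟨ proj₁ (proj₂ (choose b)) ⟩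
      toℕ b                ∎)
      where
      open ≡-Reasoning
      same-index : chosen a ≡ chosen b
      same-index = Fin-suc-injective (label-injective (part-slot-injective p h
        (chosen-outside a) (chosen-outside b) (trans (chosen-part a) (sym (chosen-part b))) slot≡))
    chosen-avoids-hub : ∀ a → slot p h (label (rim (chosen a))) ≢ slot p h (label hub)
    chosen-avoids-hub a slot≡
      with () ← label-injective (part-slot-injective p h (chosen-outside a) p≤hub (chosen-part a) slot≡)

  noWheel : ⊥
  noWheel with label hub <? p
  ... | yes hub<p = hubInClique hub<p
  ... | no  hub≮p = hubOutside (≮⇒≥ hub≮p)

complement-cliqueMultipartite-wheelFree : ∀ N p h′ →
  ¬ Contains (complement (cliqueMultipartite p (suc h′) N)) (wheel (suc h′ + suc h′))
complement-cliqueMultipartite-wheelFree N p h′ (g , g-injective , g-hom) =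
  WheelInComplement.noWheel N p h′ g g-injective g-hom

-- No spider in the colouring

module SpiderEmbedding (k s p N : ℕ) (s≤k+k : s ≤ k + k) (h∣n : 2 + k ∣ suc p)
  (N≤p+n : N ≤ p + suc p) (f : Fin (suc p) → Fin N) (f-injective : Injective _≡_ _≡_ f)
  (f-hom : ∀ u v → adj (spider (suc p) 1 s) u v ≡ true →
                   adj (cliqueMultipartite p (2 + k) N) (f u) (f v) ≡ true) where

  n h : ℕ
  n = suc p
  h = 2 + k

  centre : Fin n
  centre = Fin.zero

  label : Fin n → ℕ
  label = toℕ ∘ f

  label-injective : Injective _≡_ _≡_ label
  label-injective = f-injective ∘ toℕ-injective

  Edge : Fin n → Fin n → Set
  Edge u v = adj (spider n 1 s) u v ≡ true

  edgeAt : ∀ u v {a b} → toℕ u ≡ a → toℕ v ≡ b → spiderAdj s a b ≡ true → Edge u v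
  edgeAt u v refl refl = trans (adj-spider n s u v)

  image : ∀ u v → Edge u v → cliqueMultipartiteEdge p h (label u) (label v) ≡ true
  image u v uv = trans (sym (adj-cliqueMultipartite p h (f u) (f v) distinct)) (f-hom u v uv)
    where
    distinct : label u ≢ label v
    distinct same with label-injective same
    ... | refl with () ← trans (sym uv) (irrefl (spider n 1 s) u)

  inClique : Fin n → Bool
  inClique u = label u <ᵇ p

  inClique-edge : ∀ u v → Edge u v → inClique u ≡ inClique v
  inClique-edge u v uv = cliqueMultipartiteEdge-sameSide p h (label u) (label v) (image u v uv)

  inClique-along-leg : ∀ a (a<n : a < n) → a ≤ suc s → inClique (fromℕ< a<n) ≡ inClique centre
  inClique-along-leg zero    _     _       = refl
  inClique-along-leg (suc a) 1+a<n 1+a≤1+s =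
    trans (sym (inClique-edge _ _ leg)) (inClique-along-leg a a<n (m≤n⇒m≤1+n (s≤s⁻¹ 1+a≤1+s)))
    where
    a<n : a < n
    a<n = <-trans (n<1+n a) 1+a<n
    leg : Edge (fromℕ< a<n) (fromℕ< 1+a<n)
    leg = edgeAt _ _ (toℕ-fromℕ< a<n) (toℕ-fromℕ< 1+a<n) (spiderAdj-path s (s≤s⁻¹ 1+a≤1+s))

  inClique-constant : ∀ u → inClique u ≡ inClique centre
  inClique-constant u with toℕ u ≤? suc s
  ... | yes onLeg = subst (λ v → inClique v ≡ inClique centre) (fromℕ<-toℕ u (toℕ<n u))
                          (inClique-along-leg (toℕ u) (toℕ<n u) onLeg)
  ... | no  leaf  = sym (inClique-edge centre u
                          (edgeAt centre u refl refl (spiderAdj-centre-leaf s (≰⇒> leaf))))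

  centreInClique : inClique centre ≡ true → ⊥
  centreInClique centre∈ = <-irrefl refl (injective⇒≤ label label-injective
    (λ u → <ᵇ≡true⇒< (label u) p (trans (inClique-constant u) centre∈)))

  module CentreOutside (centre∉ : inClique centre ≡ false) where

    outside : ∀ u → p ≤ label u
    outside u = <ᵇ≡false⇒≥ (label u) p (trans (inClique-constant u) centre∉)

    offset : Fin n → ℕ
    offset u = label u ∸ p

    offset-injective : Injective _≡_ _≡_ offset
    offset-injective {u} {v} eq = label-injective (begin
      label u      ≡⟨ m∸n+n≡m (outside u) ⟨
      offset u + p ≡⟨ cong (_+ p) eq ⟩
      offset v + p ≡⟨ m∸n+n≡m (outside v) ⟩
      label v      ∎)
      where open ≡-Reasoning

    offset<n : ∀ u → offset u < n
    offset<n u = m<n+o⇒m∸n<o (label u) p (<-≤-trans (toℕ<n (f u)) N≤p+n)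

    c j : ℕ
    c = part p h (label centre)
    j = _∣_.quotient h∣n

    c<j : c < j
    c<j = m<n*o⇒m/o<n (subst (offset centre <_) (_∣_.equality h∣n) (offset<n centre))

    inPart<n : ∀ {r} → r < h → c * h + r < n
    inPart<n {r} r<h = begin-strict
      c * h + r ≡⟨ +-comm (c * h) r ⟩
      r + c * h <⟨ +-monoˡ-< (c * h) r<h ⟩
      suc c * h ≤⟨ *-monoˡ-≤ h c<j ⟩
      j * h     ≡⟨ _∣_.equality h∣n ⟨
      n         ∎
      where open ≤-Reasoning

    centreSlot : Fin h
    centreSlot = fromℕ< (m%n<n (offset centre) h)

    otherSlot : Fin (suc k) → ℕ
    otherSlot r = toℕ (punchIn centreSlot r)

    otherSlot<h : ∀ r → otherSlot r < h
    otherSlot<h r = toℕ<n (punchIn centreSlot r)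

    filled : ∀ r → ∃ λ u → offset u ≡ c * h + otherSlot r
    filled r = injective⇒surjective offset offset-injective offset<n (inPart<n (otherSlot<h r))

    member : Fin (suc k) → Fin n
    member r = proj₁ (filled r)

    member-offset : ∀ r → offset (member r) ≡ c * h + otherSlot r
    member-offset r = proj₂ (filled r)

    member-part : ∀ r → part p h (label (member r)) ≡ c
    member-part r = trans (cong (_/ h) (member-offset r)) ([m*n+o]/n≡m c h (otherSlot<h r))

    member-injective : Injective _≡_ _≡_ member
    member-injective {r} {r′} eq = punchIn-injective centreSlot r r′ (toℕ-injective (+-cancelˡ-≡ (c * h) _ _
      (trans (sym (member-offset r)) (trans (cong offset eq) (member-offset r′)))))

    nonAdjacent : ∀ r r′ → Edge (member r) (member r′) → ⊥
    nonAdjacent r r′ e = cliqueMultipartiteEdge-crossesParts p h (outside (member r)) (outside (member r′))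
      (image (member r) (member r′) e) (trans (member-part r) (sym (member-part r′)))

    member-nonNeighbour : ∀ r {b} → toℕ (member r) ≡ b → spiderAdj s 0 b ≡ true → ⊥
    member-nonNeighbour r member≡b centre-b =
      cliqueMultipartiteEdge-crossesParts p h (outside centre) (outside (member r))
        (image centre (member r) (edgeAt centre (member r) refl member≡b centre-b)) (sym (member-part r))

    member-notCentre : ∀ r → member r ≢ centre
    member-notCentre r member≡centre = punchInᵢ≢i centreSlot r (toℕ-injective (begin
      otherSlot r       ≡⟨ +-cancelˡ-≡ (c * h) _ _ offsets ⟩
      offset centre % h ≡⟨ toℕ-fromℕ< (m%n<n (offset centre) h) ⟨
      toℕ centreSlot    ∎))
      where
      open ≡-Reasoning
      offsets : c * h + otherSlot r ≡ c * h + offset centre % h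
      offsets = begin
        c * h + otherSlot r       ≡⟨ member-offset r ⟨
        offset (member r)         ≡⟨ cong offset member≡centre ⟩
        offset centre             ≡⟨ m≡m%n+[m/n]*n (offset centre) h ⟩
        offset centre % h + c * h ≡⟨ +-comm _ (c * h) ⟩
        c * h + offset centre % h ∎

    member-onLeg : ∀ r → 2 ≤ toℕ (member r) × toℕ (member r) ≤ suc s
    member-onLeg r with toℕ (member r) in t≡
    ... | zero      = ⊥-elim (member-notCentre r (toℕ-injective {j = centre} t≡))
    ... | suc zero  = ⊥-elim (member-nonNeighbour r t≡ (spiderAdj-centre-leg s))
    ... | suc (suc t) with suc (suc t) ≤? suc s
    ...   | yes onLeg = s≤s (s≤s z≤n) , onLeg
    ...   | no  leaf  = ⊥-elim (member-nonNeighbour r t≡ (spiderAdj-centre-leaf s (≰⇒> leaf)))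

    legPosition : Fin (suc k) → ℕ
    legPosition r = toℕ (member r) ∸ 2

    legPosition+2 : ∀ r → legPosition r + 2 ≡ toℕ (member r)
    legPosition+2 r = m∸n+n≡m (proj₁ (member-onLeg r))

    legPosition-injective : Injective _≡_ _≡_ legPosition
    legPosition-injective {r} {r′} eq =
      member-injective (toℕ-injective
        (trans (sym (legPosition+2 r)) (trans (cong (_+ 2) eq) (legPosition+2 r′))))

    legPosition<k+k : ∀ r → legPosition r < k + k
    legPosition<k+k r = <-≤-trans (∸-monoˡ-< (s≤s (proj₂ (member-onLeg r))) (proj₁ (member-onLeg r))) s≤k+k

    legPosition-apart : ∀ r r′ → suc (legPosition r) ≢ legPosition r′
    legPosition-apart r r′ eq = nonAdjacent r r′ (edgeAt _ _ refl consecutive (spiderAdj-path s onLeg))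
      where
      consecutive : toℕ (member r′) ≡ suc (toℕ (member r))
      consecutive =
        trans (sym (legPosition+2 r′)) (trans (cong (_+ 2) (sym eq)) (cong suc (legPosition+2 r)))
      onLeg : toℕ (member r) ≤ s
      onLeg = s≤s⁻¹ (subst (_≤ suc s) consecutive (proj₂ (member-onLeg r′)))

    impossible : ⊥
    impossible = <-irrefl refl
      (nonConsecutive-injective⇒≤ legPosition legPosition-injective legPosition<k+k legPosition-apart)

  noSpider : ⊥
  noSpider with inClique centre in centre∈?
  ... | true  = centreInClique centre∈?
  ... | false = CentreOutside.impossible centre∈?

cliqueMultipartite-spiderFree : ∀ {N p k s} → s ≤ k + k → 2 + k ∣ suc p → N ≤ p + suc p →
  ¬ Contains (cliqueMultipartite p (2 + k) N) (spider (suc p) 1 s)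
cliqueMultipartite-spiderFree {N} {p} {k} {s} s≤k+k h∣n N≤p+n (f , f-injective , f-hom) =
  SpiderEmbedding.noSpider k s p N s≤k+k h∣n N≤p+n f f-injective f-hom

ramseyAtLeast-fromColourings : ∀ {a b} (G : Graph a) (H : Graph b) k →
  (∀ N → N < k → Σ (Graph N) λ F → ¬ Contains F G × ¬ Contains (complement F) H) →
  RamseyAtLeast G H k
ramseyAtLeast-fromColourings G H k colouring N _ arrows with k ≤? N
... | yes k≤N = k≤N
... | no  k≰N with colouring N (≰⇒> k≰N)
...   | F , G∉F , H∉F̄ = ⊥-elim ([ G∉F , H∉F̄ ] (arrows F))

m*2≡m+m : ∀ m → m * 2 ≡ m + m
m*2≡m+m m = trans (*-comm m 2) (cong (m +_) (+-identityʳ m))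

spider-wheel-ramseyAtLeast : ∀ k n → 2 + k ∣ n →
  RamseyAtLeast (spider n 1 (k * 2)) (wheel ((2 + k) * 2)) (2 * n)
spider-wheel-ramseyAtLeast k zero    _   _ _ _ = z≤n
spider-wheel-ramseyAtLeast k (suc p) h∣n =
  ramseyAtLeast-fromColourings (spider (suc p) 1 (k * 2)) (wheel ((2 + k) * 2)) (2 * suc p)
    λ N N<2n →
      cliqueMultipartite p (2 + k) N ,
      cliqueMultipartite-spiderFree (≤-reflexive (m*2≡m+m k)) h∣n (N≤p+n N<2n) ,
      subst (λ m → ¬ Contains (complement (cliqueMultipartite p (2 + k) N)) (wheel m))
        (sym (m*2≡m+m (2 + k))) (complement-cliqueMultipartite-wheelFree N p (suc k))
  where
  N≤p+n : ∀ {N} → N < 2 * suc p → N ≤ p + suc p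
  N≤p+n {N} N<2n = s≤s⁻¹ (subst (N <_) (cong (suc p +_) (+-identityʳ (suc p))) N<2n)

maxDegree-spider-m∸4 : ∀ m n → 4 ≤ m → m ≤ n → maxDegree (spider n 1 (m ∸ 4)) ≡ n ∸ m + 3
maxDegree-spider-m∸4 m n 4≤m m≤n =
  subst₂ (λ n′ d → maxDegree (spider n′ 1 (m ∸ 4)) ≡ d) n≡ (sym (+-suc (n ∸ m) 2))
    (maxDegree-spider (m ∸ 4) (n ∸ m + 2) (m≤n+m 2 (n ∸ m)))
  where
  n≡ : 2 + (m ∸ 4) + (n ∸ m + 2) ≡ n
  n≡ = begin
    2 + (m ∸ 4) + (n ∸ m + 2) ≡⟨ solve 2 (λ a b → con 2 :+ a :+ (b :+ con 2) := con 4 :+ a :+ b)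
                                         refl (m ∸ 4) (n ∸ m) ⟩
    4 + (m ∸ 4) + (n ∸ m)     ≡⟨ cong (_+ (n ∸ m)) (m+[n∸m]≡n 4≤m) ⟩
    m + (n ∸ m)               ≡⟨ m+[n∸m]≡n m≤n ⟩
    n                         ∎
    where open ≡-Reasoning

multiple≥2h∸2⇒multiple≥2h : ∀ {h n} → 3 ≤ h → h ∣ n → 1 ≤ n → h * 2 ∸ 2 ≤ n → h * 2 ≤ n
multiple≥2h∸2⇒multiple≥2h _ (divides zero refl) () _
multiple≥2h∸2⇒multiple≥2h {1} (s≤s ())       (divides 1 refl) _ _
multiple≥2h∸2⇒multiple≥2h {2} (s≤s (s≤s ())) (divides 1 refl) _ _
multiple≥2h∸2⇒multiple≥2h {h@(suc (suc (suc t)))} _ (divides 1 refl) _ 2h∸2≤h =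
  ⊥-elim (<-irrefl refl (begin-strict
    h         <⟨ s≤s (+-monoʳ-≤ 3 (m≤m*n t 2)) ⟩
    h * 2 ∸ 2 ≤⟨ 2h∸2≤h ⟩
    h + 0     ≡⟨ +-identityʳ h ⟩
    h         ∎))
  where open ≤-Reasoning
multiple≥2h∸2⇒multiple≥2h {h} _ (divides (suc (suc j)) refl) _ _ =
  subst (_≤ (2 + j) * h) (*-comm 2 h) (*-monoˡ-≤ h {2} {2 + j} (s≤s (s≤s z≤n)))

corollary2 : ∀ (m n : ℕ) → 8 ≤ m → 2 ∣ m → 1 ≤ n → (m / 2) ∣ n
    → m ∸ 2 ≤ n
    → maxDegree (spider n 1 (m ∸ 4)) ≡ n ∸ m + 3
    × RamseyAtLeast (spider n 1 (m ∸ 4)) (wheel m) (2 * n)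
corollary2 .(q * 2) n 8≤m (divides q refl) 1≤n q∣n m∸2≤n
  with m≤n⇒∃[o]m+o≡n (*-cancelʳ-≤ 2 q 2 (≤-trans (m≤m+n 4 4) 8≤m))
... | k , refl = maxDegree-spider-m∸4 m n 4≤m m≤n , spider-wheel-ramseyAtLeast k n h∣n
  where
  m : ℕ
  m = (2 + k) * 2
  4≤m : 4 ≤ m
  4≤m = ≤-trans (m≤m+n 4 4) 8≤m
  h∣n : 2 + k ∣ n
  h∣n = subst (_∣ n) (m*n/n≡m (2 + k) 2) q∣n
  m≤n : m ≤ n
  m≤n = multiple≥2h∸2⇒multiple≥2h (*-cancelʳ-≤ 3 (2 + k) 2 (≤-trans (m≤m+n 6 2) 8≤m)) h∣n 1≤n m∸2≤n
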